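{- Let $F$ be a rational species with $F(\emptyset)=\emptyset$ (the empty groupoid). Define the rational species $(1+F)^{ -1}$ on a finite set $x$ by $$(1+F)^{ -1}(x)=\bigsqcup_{k\ge0}\ \bigsqcup_{(x_1,\dots,x_k)}(-1)^k\prod_{i=1}^kF(x_i),$$ where the inner disjoint union runs over ordered $k$-tuples of nonempty pairwise disjoint subsets of $x$ with $x_1\sqcup\dots\sqcup x_k=x$ (the term $k=0$ occurs only for $x=\emptyset$ and equals the groupoid $1$). Then $|(1+F)^{ -1}|=(1+|F|)^{ -1}$ in $\mathbb{Q}[[x]]$.
   Context: A $\mathbb{Z}_2$-graded finite groupoid is a groupoid with finitely many objects and finite hom-sets together with a grading $Ob(G)\to\mathbb{Z}_2$, $y\mapsto\bar y$, constant on isomorphism classes; its cardinality is $|G|=\sum_{[y]}(-1)^{\bar y}/|G(y,y)|$ over isomorphism classes of objects. Disjoint unions keep gradings, Cartesian products grade $(y,z)$ by $\bar y+\bar z$; $1$ is the groupoid with one object of degree $0$ and one morphism. For a groupoid $G$, $(-1)^kG$ is $G$ with all degrees increased by $k$ (mod 2). A rational species is a functor $F$ from the category of finite sets and bijections to the category of $\mathbb{Z}_2$-graded finite groupoids (grading-preserving functors as morphisms). Its generating series is $|F|=\sum_{n\ge0}|F([n])|\frac{x^n}{n!}\in\mathbb{Q}[[x]]$, where $[n]=\{1,\dots,n\}$, $[0]=\emptyset$. -}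

module Defs where

open import Data.Bool using (Bool; true; false; not; _xor_; _∧_; if_then_else_)
open import Data.Empty using (⊥)
open import Data.Unit using (⊤; tt)
open import Data.Nat as ℕ using (ℕ; zero; suc; _∸_; _!; _<ᵇ_; _≡ᵇ_)
open import Data.Fin as Fin using (Fin; toℕ)
open import Data.Fin.Properties using (0↔⊥; 1↔⊤; +↔⊎; *↔×; all?)
open import Data.Fin.Permutation as Perm using (Permutation′; _∘ₚ_)
open import Data.Integer using (+_; -[1+_])
open import Data.Rational as ℚ using (ℚ; 0ℚ; 1ℚ)
open import Data.List as List using (List; []; _∷_; [_]; map; concatMap; allFin; upTo; filter; foldr)
open import Data.Bool.ListAction using (any)
open import Data.Vec as Vec using (Vec; count)
open import Data.Vec.Membership.Propositional using (_∈_)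
open import Data.Product using (_×_; _,_; Σ)
open import Data.Sum using (_⊎_; inj₁; inj₂)
open import Data.Product.Function.NonDependent.Propositional using (_×-↔_)
open import Data.Sum.Function.Propositional using (_⊎-↔_)
open import Function using (_↔_; Inverse)
open import Function.Properties.Inverse using (↔-sym; ↔-trans)
open import Relation.Binary.PropositionalEquality using (_≡_; refl; cong₂; subst₂)
open import Relation.Nullary using (Dec)
import Data.Vec.Membership.DecPropositional as VecDec

-- Z₂-graded finite groupoids.
-- Z₂ is represented by Bool (false = 0, true = 1); addition is _xor_.
-- Finiteness: the object type and every hom-set come with a bijection
-- to some Fin n.

record GradedFinGroupoid : Set₁ where
  infixr 9 _∘_
  field
    Obj   : Set
    Hom   : Obj → Obj → Set
    idm   : ∀ {a} → Hom a a
    _∘_   : ∀ {a b c} → Hom b c → Hom a b → Hom a c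
    inv   : ∀ {a b} → Hom a b → Hom b a
    assoc : ∀ {a b c d} (h : Hom c d) (g : Hom b c) (f : Hom a b) →
            (h ∘ g) ∘ f ≡ h ∘ (g ∘ f)
    idˡ   : ∀ {a b} (f : Hom a b) → idm ∘ f ≡ f
    idʳ   : ∀ {a b} (f : Hom a b) → f ∘ idm ≡ f
    invˡ  : ∀ {a b} (f : Hom a b) → inv f ∘ f ≡ idm
    invʳ  : ∀ {a b} (f : Hom a b) → f ∘ inv f ≡ idm
    #Obj    : ℕ
    enumObj : Obj ↔ Fin #Obj
    #Hom    : Obj → Obj → ℕ
    enumHom : ∀ a b → Hom a b ↔ Fin (#Hom a b)
    deg     : Obj → Bool
    deg-iso : ∀ {a b} → Hom a b → deg a ≡ deg b

open GradedFinGroupoid public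

-- Cardinality |G| = Σ_{[y]} (-1)^{deg y} / |G(y,y)|.
-- Objects are enumerated as Fin #Obj; each isomorphism class is
-- counted once, via its representative of least index (an object y is
-- isomorphic to an earlier object iff some earlier hom-set into y is
-- nonempty, since every morphism of a groupoid is an isomorphism).

recip : ℕ → ℚ
recip zero    = 0ℚ          -- never used on 0 (|G(y,y)| ≥ 1, n! ≥ 1)
recip (suc k) = + 1 ℚ./ suc k

signℚ : Bool → ℚ
signℚ false = 1ℚ
signℚ true  = -[1+ 0 ] ℚ./ 1

sumℚ : List ℚ → ℚ
sumℚ = foldr ℚ._+_ 0ℚ

module _ (G : GradedFinGroupoid) where
  private
    obj : Fin (#Obj G) → Obj G
    obj = Inverse.from (enumObj G)

  hasEarlierIso : Fin (#Obj G) → Bool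
  hasEarlierIso i =
    any (λ j → (toℕ j <ᵇ toℕ i) ∧ not (#Hom G (obj j) (obj i) ≡ᵇ 0)) (allFin (#Obj G))

  classTerm : Fin (#Obj G) → ℚ
  classTerm i = if hasEarlierIso i then 0ℚ
                else signℚ (deg G (obj i)) ℚ.* recip (#Hom G (obj i) (obj i))

  card : ℚ
  card = sumℚ (map classTerm (allFin (#Obj G)))

unitG : GradedFinGroupoid
unitG = record
  { Obj = ⊤ ; Hom = λ _ _ → ⊤ ; idm = tt ; _∘_ = λ _ _ → tt ; inv = λ _ → tt
  ; assoc = λ _ _ _ → refl ; idˡ = λ _ → refl ; idʳ = λ _ → refl
  ; invˡ = λ _ → refl ; invʳ = λ _ → refl
  ; #Obj = 1 ; enumObj = ↔-sym 1↔⊤ ; #Hom = λ _ _ → 1 ; enumHom = λ _ _ → ↔-sym 1↔⊤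
  ; deg = λ _ → false ; deg-iso = λ _ → refl }

emptyG : GradedFinGroupoid
emptyG = record
  { Obj = ⊥ ; Hom = λ _ _ → ⊥ ; idm = λ {a} → ex a ; _∘_ = λ {a} _ _ → ex a
  ; inv = λ {a} _ → ex a
  ; assoc = λ {a} _ _ _ → ex a ; idˡ = λ {a} _ → ex a ; idʳ = λ {a} _ → ex a
  ; invˡ = λ {a} _ → ex a ; invʳ = λ {a} _ → ex a
  ; #Obj = 0 ; enumObj = ↔-sym 0↔⊥ ; #Hom = λ _ _ → 0 ; enumHom = λ _ _ → ↔-sym 0↔⊥
  ; deg = λ () ; deg-iso = λ {a} _ → ex a }
  where
  ex : {A : Set} → ⊥ → A
  ex ()

shift : GradedFinGroupoid → GradedFinGroupoid
shift G = record G { deg = λ a → not (deg G a)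
                   ; deg-iso = λ f → Relation.Binary.PropositionalEquality.cong not (deg-iso G f) }
  where import Relation.Binary.PropositionalEquality

shiftBy : ℕ → GradedFinGroupoid → GradedFinGroupoid
shiftBy zero    G = G
shiftBy (suc k) G = shift (shiftBy k G)

module Sum (G H : GradedFinGroupoid) where
  O : Set
  O = Obj G ⊎ Obj H

  Hm : O → O → Set
  Hm (inj₁ a) (inj₁ b) = Hom G a b
  Hm (inj₂ a) (inj₂ b) = Hom H a b
  Hm (inj₁ _) (inj₂ _) = ⊥
  Hm (inj₂ _) (inj₁ _) = ⊥

  i : ∀ {a} → Hm a a
  i {inj₁ a} = idm G
  i {inj₂ a} = idm H

  c : ∀ {a b d} → Hm b d → Hm a b → Hm a d
  c {inj₁ _} {inj₁ _} {inj₁ _} g f = _∘_ G g f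
  c {inj₂ _} {inj₂ _} {inj₂ _} g f = _∘_ H g f
  c {inj₁ _} {inj₁ _} {inj₂ _} () f
  c {inj₂ _} {inj₂ _} {inj₁ _} () f
  c {inj₁ _} {inj₂ _} {_} g ()
  c {inj₂ _} {inj₁ _} {_} g ()

  iv : ∀ {a b} → Hm a b → Hm b a
  iv {inj₁ _} {inj₁ _} f = inv G f
  iv {inj₂ _} {inj₂ _} f = inv H f
  iv {inj₁ _} {inj₂ _} ()
  iv {inj₂ _} {inj₁ _} ()

  as : ∀ {a b d e} (h : Hm d e) (g : Hm b d) (f : Hm a b) → c {a} {b} {e} (c {b} {d} {e} h g) f ≡ c {a} {d} {e} h (c {a} {b} {d} g f)
  as {inj₁ _} {inj₁ _} {inj₁ _} {inj₁ _} h g f = assoc G h g f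
  as {inj₂ _} {inj₂ _} {inj₂ _} {inj₂ _} h g f = assoc H h g f
  as {inj₁ _} {inj₁ _} {inj₁ _} {inj₂ _} () g f
  as {inj₂ _} {inj₂ _} {inj₂ _} {inj₁ _} () g f
  as {inj₁ _} {inj₁ _} {inj₂ _} {_} h () f
  as {inj₂ _} {inj₂ _} {inj₁ _} {_} h () f
  as {inj₁ _} {inj₂ _} {_} {_} h g ()
  as {inj₂ _} {inj₁ _} {_} {_} h g ()

  il : ∀ {a b} (f : Hm a b) → c {a} {b} {b} (i {b}) f ≡ f
  il {inj₁ _} {inj₁ _} f = idˡ G f
  il {inj₂ _} {inj₂ _} f = idˡ H f
  il {inj₁ _} {inj₂ _} ()
  il {inj₂ _} {inj₁ _} ()

  ir : ∀ {a b} (f : Hm a b) → c {a} {a} {b} f (i {a}) ≡ f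
  ir {inj₁ _} {inj₁ _} f = idʳ G f
  ir {inj₂ _} {inj₂ _} f = idʳ H f
  ir {inj₁ _} {inj₂ _} ()
  ir {inj₂ _} {inj₁ _} ()

  vl : ∀ {a b} (f : Hm a b) → c {a} {b} {a} (iv {a} {b} f) f ≡ i {a}
  vl {inj₁ _} {inj₁ _} f = invˡ G f
  vl {inj₂ _} {inj₂ _} f = invˡ H f
  vl {inj₁ _} {inj₂ _} ()
  vl {inj₂ _} {inj₁ _} ()

  vr : ∀ {a b} (f : Hm a b) → c {b} {a} {b} f (iv {a} {b} f) ≡ i {b}
  vr {inj₁ _} {inj₁ _} f = invʳ G f
  vr {inj₂ _} {inj₂ _} f = invʳ H f
  vr {inj₁ _} {inj₂ _} ()
  vr {inj₂ _} {inj₁ _} ()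

  nH : O → O → ℕ
  nH (inj₁ a) (inj₁ b) = #Hom G a b
  nH (inj₂ a) (inj₂ b) = #Hom H a b
  nH (inj₁ _) (inj₂ _) = 0
  nH (inj₂ _) (inj₁ _) = 0

  eH : ∀ a b → Hm a b ↔ Fin (nH a b)
  eH (inj₁ a) (inj₁ b) = enumHom G a b
  eH (inj₂ a) (inj₂ b) = enumHom H a b
  eH (inj₁ _) (inj₂ _) = ↔-sym 0↔⊥
  eH (inj₂ _) (inj₁ _) = ↔-sym 0↔⊥

  dg : O → Bool
  dg (inj₁ a) = deg G a
  dg (inj₂ a) = deg H a

  di : ∀ {a b} → Hm a b → dg a ≡ dg b
  di {inj₁ _} {inj₁ _} f = deg-iso G f
  di {inj₂ _} {inj₂ _} f = deg-iso H f
  di {inj₁ _} {inj₂ _} ()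
  di {inj₂ _} {inj₁ _} ()

infixr 5 _⊔_
_⊔_ : GradedFinGroupoid → GradedFinGroupoid → GradedFinGroupoid
G ⊔ H = record
  { Obj = O ; Hom = Hm ; idm = λ {a} → i {a}
  ; _∘_ = λ {a} {b} {d} → c {a} {b} {d} ; inv = λ {a} {b} → iv {a} {b}
  ; assoc = λ {a} {b} {d} {e} → as {a} {b} {d} {e}
  ; idˡ = λ {a} {b} → il {a} {b} ; idʳ = λ {a} {b} → ir {a} {b}
  ; invˡ = λ {a} {b} → vl {a} {b} ; invʳ = λ {a} {b} → vr {a} {b}
  ; #Obj = #Obj G ℕ.+ #Obj H
  ; enumObj = ↔-trans (enumObj G ⊎-↔ enumObj H) (↔-sym +↔⊎)
  ; #Hom = nH ; enumHom = eH ; deg = dg ; deg-iso = λ {a} {b} → di {a} {b} }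
  where open Sum G H

infixr 6 _⊗_
_⊗_ : GradedFinGroupoid → GradedFinGroupoid → GradedFinGroupoid
G ⊗ H = record
  { Obj = Obj G × Obj H
  ; Hom = λ { (a , a') (b , b') → Hom G a b × Hom H a' b' }
  ; idm = idm G , idm H
  ; _∘_ = λ { (g , g') (f , f') → _∘_ G g f , _∘_ H g' f' }
  ; inv = λ { (f , f') → inv G f , inv H f' }
  ; assoc = λ { (h , h') (g , g') (f , f') → cong₂ _,_ (assoc G h g f) (assoc H h' g' f') }
  ; idˡ = λ { (f , f') → cong₂ _,_ (idˡ G f) (idˡ H f') }
  ; idʳ = λ { (f , f') → cong₂ _,_ (idʳ G f) (idʳ H f') }
  ; invˡ = λ { (f , f') → cong₂ _,_ (invˡ G f) (invˡ H f') }
  ; invʳ = λ { (f , f') → cong₂ _,_ (invʳ G f) (invʳ H f') }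
  ; #Obj = #Obj G ℕ.* #Obj H
  ; enumObj = ↔-trans (enumObj G ×-↔ enumObj H) (↔-sym *↔×)
  ; #Hom = λ { (a , a') (b , b') → #Hom G a b ℕ.* #Hom H a' b' }
  ; enumHom = λ { (a , a') (b , b') →
      ↔-trans (enumHom G a b ×-↔ enumHom H a' b') (↔-sym *↔×) }
  ; deg = λ { (a , a') → deg G a xor deg H a' }
  ; deg-iso = λ { (f , f') → cong₂ _xor_ (deg-iso G f) (deg-iso H f') }
  }

⨆ : List GradedFinGroupoid → GradedFinGroupoid
⨆ = foldr _⊔_ emptyG

∏ : List GradedFinGroupoid → GradedFinGroupoid
∏ = foldr _⊗_ unitG

-- A species is given on the skeleton of the category of finite sets and
-- bijections: a groupoid F[n] for each n, and a functorial action of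
-- the bijections Fin n ↔ Fin n.

record GradedFunctor (G H : GradedFinGroupoid) : Set where
  field
    fobj   : Obj G → Obj H
    fhom   : ∀ {a b} → Hom G a b → Hom H (fobj a) (fobj b)
    f-id   : ∀ {a} → fhom (idm G {a}) ≡ idm H
    f-comp : ∀ {a b c} (g : Hom G b c) (f : Hom G a b) →
             fhom (_∘_ G g f) ≡ _∘_ H (fhom g) (fhom f)
    f-deg  : ∀ a → deg H (fobj a) ≡ deg G a

open GradedFunctor public

idF : (G : GradedFinGroupoid) → GradedFunctor G G
idF G = record { fobj = λ a → a ; fhom = λ f → f ; f-id = refl
               ; f-comp = λ _ _ → refl ; f-deg = λ _ → refl }

_∘F_ : ∀ {G H K} → GradedFunctor H K → GradedFunctor G H → GradedFunctor G K
_∘F_ {G} {H} {K} Φ Ψ = record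
  { fobj = λ a → fobj Φ (fobj Ψ a)
  ; fhom = λ f → fhom Φ (fhom Ψ f)
  ; f-id = trans (cong (fhom Φ) (f-id Ψ)) (f-id Φ)
  ; f-comp = λ g f → trans (cong (fhom Φ) (f-comp Ψ g f)) (f-comp Φ (fhom Ψ g) (fhom Ψ f))
  ; f-deg = λ a → trans (f-deg Φ (fobj Ψ a)) (f-deg Ψ a) }
  where open Relation.Binary.PropositionalEquality using (trans; cong)
        import Relation.Binary.PropositionalEquality

_≈F_ : ∀ {G H} → GradedFunctor G H → GradedFunctor G H → Set
_≈F_ {G} {H} Φ Ψ =
  Σ (∀ a → fobj Φ a ≡ fobj Ψ a) λ p →
    ∀ {a b} (f : Hom G a b) → subst₂ (Hom H) (p a) (p b) (fhom Φ f) ≡ fhom Ψ f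

record Species : Set₁ where
  field
    grp    : ℕ → GradedFinGroupoid
    act    : ∀ {n} → Permutation′ n → GradedFunctor (grp n) (grp n)
    act-cong : ∀ {n} {π ρ : Permutation′ n} → π Perm.≈ ρ → act π ≈F act ρ
    act-id : ∀ {n} → act (Perm.id {n}) ≈F idF (grp n)
    -- π ∘ₚ ρ is "first π, then ρ"
    act-∘  : ∀ {n} (π ρ : Permutation′ n) → act (π ∘ₚ ρ) ≈F (act ρ ∘F act π)

open Species public

-- An ordered k-tuple (x₁,…,x_k) of nonempty pairwise disjoint subsets of
-- [n] with union [n] is encoded by the map v : [n] → [k] (a vector in
-- Vec (Fin k) n) sending each element to the index of its block; the
-- tuple conditions say exactly that v is surjective, and x_i = v⁻¹(i).
-- F(x_i) is F[|x_i|] (transport along the order-preserving bijection).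
-- Summands with k > n are empty (no surjection [n] → [k]) and omitted.

allVecs : (k n : ℕ) → List (Vec (Fin k) n)
allVecs k zero    = [ Vec.[] ]
allVecs k (suc n) = concatMap (λ a → map (a Vec.∷_) (allVecs k n)) (allFin k)

Surjective : ∀ {k n} → Vec (Fin k) n → Set
Surjective v = ∀ i → i ∈ v

surjective? : ∀ {k n} (v : Vec (Fin k) n) → Dec (Surjective v)
surjective? v = all? (λ i → VecDec._∈?_ Fin._≟_ i v)

orderedPartitions : (k n : ℕ) → List (Vec (Fin k) n)
orderedPartitions k n = filter surjective? (allVecs k n)

blockSize : ∀ {k n} → Vec (Fin k) n → Fin k → ℕ
blockSize v i = count (Fin._≟ i) v

invSpeciesAt : Species → ℕ → GradedFinGroupoid
invSpeciesAt F n =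
  ⨆ (concatMap (λ k →
        map (λ v → shiftBy k (∏ (map (λ i → grp F (blockSize v i)) (allFin k))))
            (orderedPartitions k n))
      (upTo (suc n)))

PowerSeries : Set
PowerSeries = ℕ → ℚ

_≈ₛ_ : PowerSeries → PowerSeries → Set
a ≈ₛ b = ∀ n → a n ≡ b n

1ₛ : PowerSeries
1ₛ zero    = 1ℚ
1ₛ (suc _) = 0ℚ

_+ₛ_ : PowerSeries → PowerSeries → PowerSeries
(a +ₛ b) n = a n ℚ.+ b n

_*ₛ_ : PowerSeries → PowerSeries → PowerSeries
(a *ₛ b) n = sumℚ (map (λ j → a j ℚ.* b (n ∸ j)) (upTo (suc n)))

genSeriesOf : (ℕ → GradedFinGroupoid) → PowerSeries
genSeriesOf G n = card (G n) ℚ.* recip (n !)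

∣_∣ₛ : Species → PowerSeries
∣ F ∣ₛ = genSeriesOf (grp F)

-- Write c m = |F[m]| and f = |F|, so f_m = c m / m!.  Cardinality of graded
-- groupoids is additive on ⊔, multiplicative on ⊗, changes sign under a
-- degree shift and vanishes on groupoids without objects.  Encoding ordered
-- partitions of [n] into k blocks as surjective words v ∈ [k]ⁿ, this gives
--   |(1+F)⁻¹[n]| = Σ_{k≤n} (-1)ᵏ T k n,   T k n = Σ_{v ∈ [k]ⁿ} Π_i c |v⁻¹(i)|,
-- where non-surjective words may be added freely because c 0 = |F[∅]| = 0.
-- Splitting a word over [k+1] into the positions of the letter 0 and the
-- remaining word over [k] yields the binomial recursion
--   T (k+1) n = Σ_j C(n,j) · c (n-j) · T k j,
-- so t k n = T k n / n! are the coefficients of fᵏ (t (k+1) = t k · f,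
-- t 0 = 1) and t k n = 0 for n < k.  Hence g = Σ_k (-1)ᵏ t k and the
-- product g · (1 + f) telescopes to 1.
module Submission where

open import Defs
open import Data.Empty using (⊥; ⊥-elim)
open import Data.Unit using (tt)
open import Data.Bool using (Bool; true; false; not; _xor_; _∧_; _∨_; if_then_else_)
import Data.Bool.Properties as BoolP
open import Data.Bool.ListAction using (any)
open import Data.Nat as ℕ using (ℕ; zero; suc; _∸_; _!; _<ᵇ_; _≡ᵇ_; z≤n; s≤s)
import Data.Nat.Properties as ℕP
open import Data.Nat.Combinatorics using (_C_; nCk≡n!/k![n-k]!; k![n∸k]!∣n!; k>n⇒nCk≡0; nCk+nC[k+1]≡[n+1]C[k+1])
open import Data.Nat.DivMod using (m/n*n≡m)
open import Data.Fin as Fin using (Fin; toℕ; _↑ˡ_; _↑ʳ_; combine; remQuot)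
open import Data.Fin.Properties using (splitAt-↑ˡ; splitAt-↑ʳ; remQuot-combine; combine-remQuot; toℕ-↑ˡ; toℕ-↑ʳ; toℕ-combine; toℕ<n; ¬∀⟶∃¬)
import Data.Integer as ℤ
import Data.Integer.Properties as ℤP
open import Data.Rational as ℚ using (ℚ; 0ℚ; 1ℚ; _+_; _*_; -_)
import Data.Rational.Properties as ℚP
open import Data.Rational.Unnormalised as ℚᵘ using (mkℚᵘ)
import Data.Rational.Unnormalised.Properties as ℚᵘP
open import Data.Rational.Solver using (module +-*-Solver)
open import Data.List using (List; []; _∷_; map; concatMap; allFin; upTo; filter; foldr; _++_; applyUpTo)
import Data.List.Properties as LP
open import Data.List.Membership.Propositional using (_∈_)
open import Data.List.Membership.Propositional.Properties using (∈-allFin)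
open import Data.List.Relation.Unary.Any using (here; there)
open import Data.Vec as Vec using (Vec)
import Data.Vec.Membership.Propositional as VecMem
import Data.Vec.Membership.DecPropositional as VecDec
open import Data.Vec.Relation.Unary.Any using () renaming (here to vhere; there to vthere)
open import Data.Product using (Σ; _,_; proj₁; proj₂; _×_)
open import Data.Sum using (_⊎_; inj₁; inj₂)
open import Function using (Inverse; _↔_)
open import Relation.Nullary using (¬_; Dec; yes; no)
open import Relation.Binary.Definitions using (tri<; tri≈; tri>)
open import Relation.Binary.PropositionalEquality
open ≡-Reasoning
open +-*-Solver using (solve; _:+_; _:*_; :-_; _:=_; con)

sum-++ : (xs ys : List ℚ) → sumℚ (xs ++ ys) ≡ sumℚ xs + sumℚ ys
sum-++ []       ys = sym (ℚP.+-identityˡ _)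
sum-++ (x ∷ xs) ys = trans (cong (x +_) (sum-++ xs ys)) (sym (ℚP.+-assoc x _ _))

sum-cong : ∀ {a} {A : Set a} {f g : A → ℚ} (L : List A) → (∀ x → f x ≡ g x) →
           sumℚ (map f L) ≡ sumℚ (map g L)
sum-cong []      e = refl
sum-cong (x ∷ L) e = cong₂ _+_ (e x) (sum-cong L e)

sum-map-*ˡ : ∀ {A : Set} (c : ℚ) (f : A → ℚ) (L : List A) →
             sumℚ (map (λ x → c * f x) L) ≡ c * sumℚ (map f L)
sum-map-*ˡ c f []      = sym (ℚP.*-zeroʳ c)
sum-map-*ˡ c f (x ∷ L) = trans (cong ((c * f x) +_) (sum-map-*ˡ c f L)) (sym (ℚP.*-distribˡ-+ c _ _))

sum-map-*ʳ : ∀ {A : Set} (c : ℚ) (f : A → ℚ) (L : List A) →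
             sumℚ (map (λ x → f x * c) L) ≡ sumℚ (map f L) * c
sum-map-*ʳ c f []      = sym (ℚP.*-zeroˡ c)
sum-map-*ʳ c f (x ∷ L) = trans (cong ((f x * c) +_) (sum-map-*ʳ c f L)) (sym (ℚP.*-distribʳ-+ c (f x) _))

sum-map-neg : ∀ {A : Set} (f : A → ℚ) (L : List A) →
              sumℚ (map (λ x → - f x) L) ≡ - sumℚ (map f L)
sum-map-neg f []      = refl
sum-map-neg f (x ∷ L) = trans (cong ((- f x) +_) (sum-map-neg f L))
  (solve 2 (λ a b → (:- a) :+ (:- b) := :- (a :+ b)) refl (f x) (sumℚ (map f L)))

sum-concatMap : ∀ {a b} {A : Set a} {B : Set b} (f : B → ℚ) (g : A → List B) (L : List A) →
  sumℚ (map f (concatMap g L)) ≡ sumℚ (map (λ x → sumℚ (map f (g x))) L)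
sum-concatMap f g []      = refl
sum-concatMap f g (x ∷ L) = begin
  sumℚ (map f (g x ++ concatMap g L))                ≡⟨ cong sumℚ (LP.map-++ f (g x) (concatMap g L)) ⟩
  sumℚ (map f (g x) ++ map f (concatMap g L))        ≡⟨ sum-++ (map f (g x)) _ ⟩
  sumℚ (map f (g x)) + sumℚ (map f (concatMap g L))  ≡⟨ cong (sumℚ (map f (g x)) +_) (sum-concatMap f g L) ⟩
  sumℚ (map (λ y → sumℚ (map f (g y))) (x ∷ L))      ∎

sum-filter : ∀ {A : Set} {P : A → Set} (P? : ∀ x → Dec (P x)) (f : A → ℚ) (L : List A) →
  (∀ x → ¬ P x → f x ≡ 0ℚ) → sumℚ (map f (filter P? L)) ≡ sumℚ (map f L)
sum-filter P? f []      e = refl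
sum-filter P? f (x ∷ L) e with P? x
... | yes _  = cong (f x +_) (sum-filter P? f L e)
... | no ¬px = begin
  sumℚ (map f (filter P? L))  ≡⟨ sum-filter P? f L e ⟩
  sumℚ (map f L)              ≡⟨ ℚP.+-identityˡ _ ⟨
  0ℚ + sumℚ (map f L)         ≡⟨ cong (_+ sumℚ (map f L)) (e x ¬px) ⟨
  f x + sumℚ (map f L)        ∎

prodℚ : List ℚ → ℚ
prodℚ = foldr _*_ 1ℚ

prod-zero : ∀ {A : Set} (f : A → ℚ) {L : List A} {x} → x ∈ L → f x ≡ 0ℚ → prodℚ (map f L) ≡ 0ℚ
prod-zero f {x ∷ L} (here refl) e = trans (cong (_* prodℚ (map f L)) e) (ℚP.*-zeroˡ (prodℚ (map f L)))
prod-zero f {y ∷ L} (there x∈L) e = trans (cong (f y *_) (prod-zero f x∈L e)) (ℚP.*-zeroʳ (f y))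

sumBelow : ℕ → (ℕ → ℚ) → ℚ
sumBelow zero    f = 0ℚ
sumBelow (suc n) f = f 0 + sumBelow n (λ k → f (suc k))

upTo-sumBelow : ∀ n (f : ℕ → ℚ) → sumℚ (map f (upTo n)) ≡ sumBelow n f
upTo-sumBelow n f = go n (λ k → k)
  where
  go : ∀ n (g : ℕ → ℕ) → sumℚ (map f (applyUpTo g n)) ≡ sumBelow n (λ k → f (g k))
  go zero    g = refl
  go (suc n) g = cong (f (g 0) +_) (go n (λ k → g (suc k)))

sumBelow-cong : ∀ n {f g : ℕ → ℚ} → (∀ k → k ℕ.< n → f k ≡ g k) → sumBelow n f ≡ sumBelow n g
sumBelow-cong zero    e = refl
sumBelow-cong (suc n) e = cong₂ _+_ (e 0 (s≤s z≤n)) (sumBelow-cong n (λ k k<n → e (suc k) (s≤s k<n)))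

sumBelow-zero : ∀ n {f : ℕ → ℚ} → (∀ k → k ℕ.< n → f k ≡ 0ℚ) → sumBelow n f ≡ 0ℚ
sumBelow-zero zero    e = refl
sumBelow-zero (suc n) e = trans (cong₂ _+_ (e 0 (s≤s z≤n)) (sumBelow-zero n (λ k k<n → e (suc k) (s≤s k<n))))
                                (ℚP.+-identityˡ 0ℚ)

sumBelow-last : ∀ n (f : ℕ → ℚ) → sumBelow (suc n) f ≡ sumBelow n f + f n
sumBelow-last zero    f = trans (ℚP.+-identityʳ (f 0)) (sym (ℚP.+-identityˡ (f 0)))
sumBelow-last (suc n) f = trans (cong (f 0 +_) (sumBelow-last n (λ k → f (suc k)))) (sym (ℚP.+-assoc (f 0) _ _))

sumBelow-+ : ∀ n (f g : ℕ → ℚ) → sumBelow n (λ k → f k + g k) ≡ sumBelow n f + sumBelow n g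
sumBelow-+ zero    f g = refl
sumBelow-+ (suc n) f g = trans (cong ((f 0 + g 0) +_) (sumBelow-+ n (λ k → f (suc k)) (λ k → g (suc k))))
  (solve 4 (λ a b c d → (a :+ b) :+ (c :+ d) := (a :+ c) :+ (b :+ d)) refl (f 0) (g 0) _ _)

sumBelow-*ʳ : ∀ n (c : ℚ) (f : ℕ → ℚ) → sumBelow n (λ k → f k * c) ≡ sumBelow n f * c
sumBelow-*ʳ zero    c f = sym (ℚP.*-zeroˡ c)
sumBelow-*ʳ (suc n) c f = trans (cong ((f 0 * c) +_) (sumBelow-*ʳ n c (λ k → f (suc k))))
                                (sym (ℚP.*-distribʳ-+ c (f 0) _))

sumBelow-neg : ∀ n (f : ℕ → ℚ) → sumBelow n (λ k → - f k) ≡ - sumBelow n f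
sumBelow-neg zero    f = refl
sumBelow-neg (suc n) f = trans (cong ((- f 0) +_) (sumBelow-neg n (λ k → f (suc k))))
  (solve 2 (λ a b → (:- a) :+ (:- b) := :- (a :+ b)) refl (f 0) _)

sumBelow-swap : ∀ n m (f : ℕ → ℕ → ℚ) →
  sumBelow n (λ i → sumBelow m (f i)) ≡ sumBelow m (λ j → sumBelow n (λ i → f i j))
sumBelow-swap zero    m f = sym (sumBelow-zero m (λ _ _ → refl))
sumBelow-swap (suc n) m f = trans (cong (sumBelow m (f 0) +_) (sumBelow-swap n m (λ i → f (suc i))))
  (sym (sumBelow-+ m (f 0) (λ j → sumBelow n (λ i → f (suc i) j))))

sum-sumBelow-swap : ∀ {A : Set} n (f : A → ℕ → ℚ) (L : List A) →
  sumℚ (map (λ a → sumBelow n (f a)) L) ≡ sumBelow n (λ j → sumℚ (map (λ a → f a j) L))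
sum-sumBelow-swap n f []      = sym (sumBelow-zero n (λ _ _ → refl))
sum-sumBelow-swap n f (x ∷ L) = trans (cong (sumBelow n (f x) +_) (sum-sumBelow-swap n f L))
                                      (sym (sumBelow-+ n (f x) _))

sumBelow-extend : ∀ m n (f : ℕ → ℚ) → m ℕ.≤ n → (∀ k → m ℕ.≤ k → k ℕ.< n → f k ≡ 0ℚ) →
                  sumBelow n f ≡ sumBelow m f
sumBelow-extend m zero    f z≤n e = refl
sumBelow-extend m (suc n) f m≤1+n e with ℕP.m≤n⇒m<n∨m≡n m≤1+n
... | inj₂ refl      = refl
... | inj₁ (s≤s m≤n) = begin
  sumBelow (suc n) f      ≡⟨ sumBelow-last n f ⟩
  sumBelow n f + f n      ≡⟨ cong₂ _+_ (sumBelow-extend m n f m≤n (λ k m≤k k<n → e k m≤k (ℕP.m≤n⇒m≤1+n k<n)))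
                                       (e n m≤n ℕP.≤-refl) ⟩
  sumBelow m f + 0ℚ       ≡⟨ ℚP.+-identityʳ _ ⟩
  sumBelow m f            ∎

signed : ℕ → ℚ → ℚ
signed zero    x = x
signed (suc k) x = - signed k x

signed-*ʳ : ∀ k x y → signed k x * y ≡ signed k (x * y)
signed-*ʳ zero    x y = refl
signed-*ʳ (suc k) x y = trans (solve 2 (λ a b → (:- a) :* b := :- (a :* b)) refl (signed k x) y)
                              (cong -_ (signed-*ʳ k x y))

signed-0 : ∀ k → signed k 0ℚ ≡ 0ℚ
signed-0 zero    = refl
signed-0 (suc k) = cong -_ (signed-0 k)

sum-signed : ∀ {A : Set} k (f : A → ℚ) (L : List A) →
             sumℚ (map (λ x → signed k (f x)) L) ≡ signed k (sumℚ (map f L))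
sum-signed zero    f L = refl
sum-signed (suc k) f L = trans (sum-map-neg (λ x → signed k (f x)) L) (cong -_ (sum-signed k f L))

sumBelow-signed : ∀ k n (u : ℕ → ℚ) → sumBelow n (λ j → signed k (u j)) ≡ signed k (sumBelow n u)
sumBelow-signed zero    n u = refl
sumBelow-signed (suc k) n u = trans (sumBelow-neg n (λ j → signed k (u j))) (cong -_ (sumBelow-signed k n u))

telescope : ∀ N (u : ℕ → ℚ) →
  sumBelow (suc N) (λ k → signed k (u k)) + sumBelow (suc N) (λ k → signed k (u (suc k)))
    ≡ u 0 + signed N (u (suc N))
telescope N u = trans (cong₂ _+_ (cong (u 0 +_) (sumBelow-neg N (λ k → signed k (u (suc k)))))
                                 (sumBelow-last N (λ k → signed k (u (suc k)))))
  (solve 3 (λ a x y → (a :+ :- x) :+ (x :+ y) := a :+ y) refl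
     (u 0) (sumBelow N (λ k → signed k (u (suc k)))) (signed N (u (suc N))))

allFin-suc : ∀ k → allFin (suc k) ≡ Fin.zero ∷ map Fin.suc (allFin k)
allFin-suc k = cong (Fin.zero ∷_) (sym (LP.map-tabulate (λ i → i) Fin.suc))

allFin-+ : ∀ m n → allFin (m ℕ.+ n) ≡ map (_↑ˡ n) (allFin m) ++ map (m ↑ʳ_) (allFin n)
allFin-+ zero    n = sym (LP.map-id (allFin n))
allFin-+ (suc m) n = begin
  allFin (suc (m ℕ.+ n))
    ≡⟨ allFin-suc (m ℕ.+ n) ⟩
  Fin.zero ∷ map Fin.suc (allFin (m ℕ.+ n))
    ≡⟨ cong (λ l → Fin.zero ∷ map Fin.suc l) (allFin-+ m n) ⟩
  Fin.zero ∷ map Fin.suc (map (_↑ˡ n) (allFin m) ++ map (m ↑ʳ_) (allFin n))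
    ≡⟨ cong (Fin.zero ∷_) (LP.map-++ Fin.suc (map (_↑ˡ n) (allFin m)) _) ⟩
  Fin.zero ∷ (map Fin.suc (map (_↑ˡ n) (allFin m)) ++ map Fin.suc (map (m ↑ʳ_) (allFin n)))
    ≡⟨ cong₂ (λ a b → Fin.zero ∷ (a ++ b)) (trans (sym (LP.map-∘ (allFin m))) (LP.map-∘ (allFin m)))
                                            (sym (LP.map-∘ (allFin n))) ⟩
  Fin.zero ∷ (map (_↑ˡ n) (map Fin.suc (allFin m)) ++ map (suc m ↑ʳ_) (allFin n))
    ≡⟨ cong (λ l → map (_↑ˡ n) l ++ map (suc m ↑ʳ_) (allFin n)) (sym (allFin-suc m)) ⟩
  map (_↑ˡ n) (allFin (suc m)) ++ map (suc m ↑ʳ_) (allFin n) ∎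

allFin-* : ∀ m n → allFin (m ℕ.* n) ≡ concatMap (λ a → map (combine a) (allFin n)) (allFin m)
allFin-* zero    n = refl
allFin-* (suc m) n = begin
  allFin (n ℕ.+ m ℕ.* n)
    ≡⟨ allFin-+ n (m ℕ.* n) ⟩
  map (_↑ˡ (m ℕ.* n)) (allFin n) ++ map (n ↑ʳ_) (allFin (m ℕ.* n))
    ≡⟨ cong (λ l → first ++ map (n ↑ʳ_) l) (allFin-* m n) ⟩
  first ++ map (n ↑ʳ_) (concatMap (rowsOf m) (allFin m))
    ≡⟨ cong (first ++_) (trans (LP.map-concatMap (n ↑ʳ_) (rowsOf m) (allFin m))
                               (LP.concatMap-cong (λ a → sym (LP.map-∘ (allFin n))) (allFin m))) ⟩
  first ++ concatMap (λ a → rows (Fin.suc a)) (allFin m)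
    ≡⟨ cong (first ++_) (sym (LP.concatMap-map rows Fin.suc (allFin m))) ⟩
  concatMap rows (Fin.zero ∷ map Fin.suc (allFin m))
    ≡⟨ cong (concatMap rows) (sym (allFin-suc m)) ⟩
  concatMap rows (allFin (suc m)) ∎
  where
  rowsOf : ∀ k → Fin k → List (Fin (k ℕ.* n))
  rowsOf k a = map (combine a) (allFin n)
  rows : Fin (suc m) → List (Fin (suc m ℕ.* n))
  rows = rowsOf (suc m)
  first : List (Fin (suc m ℕ.* n))
  first = map (_↑ˡ (m ℕ.* n)) (allFin n)

bool-ext : ∀ {x y : Bool} → (x ≡ true → y ≡ true) → (y ≡ true → x ≡ true) → x ≡ y
bool-ext {false} {false} _ _ = refl
bool-ext {false} {true}  _ g = g refl
bool-ext {true}  {false} f _ = sym (f refl)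
bool-ext {true}  {true}  _ _ = refl

∧-split : ∀ {x y} → x ∧ y ≡ true → x ≡ true × y ≡ true
∧-split {true} {true} _ = refl , refl

∨-split : ∀ {x y} → x ∨ y ≡ true → x ≡ true ⊎ y ≡ true
∨-split {true}  _ = inj₁ refl
∨-split {false} e = inj₂ e

<ᵇ⇒< : ∀ m n → (m <ᵇ n) ≡ true → m ℕ.< n
<ᵇ⇒< m n e = ℕP.<ᵇ⇒< m n (subst Data.Bool.T (sym e) tt)

<⇒<ᵇ : ∀ {m n} → m ℕ.< n → (m <ᵇ n) ≡ true
<⇒<ᵇ {m} {n} m<n with m <ᵇ n | ℕP.<⇒<ᵇ m<n
... | true | _ = refl

≤⇒≮ᵇ : ∀ m n → n ℕ.≤ m → (m <ᵇ n) ≡ false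
≤⇒≮ᵇ m n n≤m with m <ᵇ n in eq
... | false = refl
... | true  = ⊥-elim (ℕP.<⇒≱ (<ᵇ⇒< m n eq) n≤m)

+-cancel-<ᵇ : ∀ k a b → (k ℕ.+ a <ᵇ k ℕ.+ b) ≡ (a <ᵇ b)
+-cancel-<ᵇ zero    a b = refl
+-cancel-<ᵇ (suc k) a b = +-cancel-<ᵇ k a b

any-++ : ∀ {A : Set} (p : A → Bool) xs ys → any p (xs ++ ys) ≡ any p xs ∨ any p ys
any-++ p []       ys = refl
any-++ p (x ∷ xs) ys = trans (cong (p x ∨_) (any-++ p xs ys)) (sym (BoolP.∨-assoc (p x) _ _))

any-map : ∀ {A B : Set} (p : B → Bool) (f : A → B) xs → any p (map f xs) ≡ any (λ x → p (f x)) xs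
any-map p f xs = cong Data.Bool.ListAction.or (sym (LP.map-∘ xs))

any-cong : ∀ {A : Set} {p q : A → Bool} xs → (∀ x → p x ≡ q x) → any p xs ≡ any q xs
any-cong []       e = refl
any-cong (x ∷ xs) e = cong₂ _∨_ (e x) (any-cong xs e)

any-false : ∀ {A : Set} {p : A → Bool} xs → (∀ x → p x ≡ false) → any p xs ≡ false
any-false []       e = refl
any-false (x ∷ xs) e rewrite e x = any-false xs e

any-witness : ∀ {A : Set} (p : A → Bool) xs → any p xs ≡ true → Σ A (λ x → p x ≡ true)
any-witness p (x ∷ xs) e with p x in eq
... | true  = x , eq
... | false = any-witness p xs e

any-intro : ∀ {A : Set} (p : A → Bool) {xs} {x} → x ∈ xs → p x ≡ true → any p xs ≡ true
any-intro p {x ∷ xs} (here refl) e rewrite e = refl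
any-intro p {y ∷ xs} (there x∈xs) e rewrite any-intro p x∈xs e = BoolP.∨-zeroʳ (p y)

any-allFin-+ : ∀ m n (p : Fin (m ℕ.+ n) → Bool) →
  any p (allFin (m ℕ.+ n)) ≡ any (λ j → p (j ↑ˡ n)) (allFin m) ∨ any (λ j → p (m ↑ʳ j)) (allFin n)
any-allFin-+ m n p = begin
  any p (allFin (m ℕ.+ n))
    ≡⟨ cong (any p) (allFin-+ m n) ⟩
  any p (map (_↑ˡ n) (allFin m) ++ map (m ↑ʳ_) (allFin n))
    ≡⟨ any-++ p (map (_↑ˡ n) (allFin m)) _ ⟩
  any p (map (_↑ˡ n) (allFin m)) ∨ any p (map (m ↑ʳ_) (allFin n))
    ≡⟨ cong₂ _∨_ (any-map p _ (allFin m)) (any-map p _ (allFin n)) ⟩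
  any (λ j → p (j ↑ˡ n)) (allFin m) ∨ any (λ j → p (m ↑ʳ j)) (allFin n) ∎

-- "k ≠ 0" as a boolean flag, the form in which nonempty hom-sets are tested.
NonZeroᵇ : ℕ → Set
NonZeroᵇ k = not (k ≡ᵇ 0) ≡ true

nonZeroᵇ-fin : ∀ {k} → Fin k → NonZeroᵇ k
nonZeroᵇ-fin {suc k} _ = refl

nonZeroᵇ-*ˡ : ∀ a b → NonZeroᵇ (a ℕ.* b) → NonZeroᵇ a
nonZeroᵇ-*ˡ (suc a) b _ = refl

nonZeroᵇ-*ʳ : ∀ a b → NonZeroᵇ (a ℕ.* b) → NonZeroᵇ b
nonZeroᵇ-*ʳ a (suc b) _ = refl
nonZeroᵇ-*ʳ a zero    e rewrite ℕP.*-zeroʳ a = e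

nonZeroᵇ-* : ∀ a b → NonZeroᵇ a → NonZeroᵇ b → NonZeroᵇ (a ℕ.* b)
nonZeroᵇ-* (suc a) (suc b) _ _ = refl

-- Both are
-- images of unnormalised rationals, on which + and * are computed
-- componentwise, so their algebra is transported along fromℚᵘ.

fromℚᵘ-homo-* : ∀ p q → ℚ.fromℚᵘ (p ℚᵘ.* q) ≡ ℚ.fromℚᵘ p * ℚ.fromℚᵘ q
fromℚᵘ-homo-* p q = ℚP.toℚᵘ-injective (ℚᵘP.≃-trans (ℚP.toℚᵘ-fromℚᵘ (p ℚᵘ.* q))
  (ℚᵘP.≃-trans (ℚᵘP.*-cong (ℚᵘP.≃-sym (ℚP.toℚᵘ-fromℚᵘ p)) (ℚᵘP.≃-sym (ℚP.toℚᵘ-fromℚᵘ q)))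
               (ℚᵘP.≃-sym (ℚP.toℚᵘ-homo-* (ℚ.fromℚᵘ p) (ℚ.fromℚᵘ q)))))

fromℚᵘ-homo-+ : ∀ p q → ℚ.fromℚᵘ (p ℚᵘ.+ q) ≡ ℚ.fromℚᵘ p + ℚ.fromℚᵘ q
fromℚᵘ-homo-+ p q = ℚP.toℚᵘ-injective (ℚᵘP.≃-trans (ℚP.toℚᵘ-fromℚᵘ (p ℚᵘ.+ q))
  (ℚᵘP.≃-trans (ℚᵘP.+-cong (ℚᵘP.≃-sym (ℚP.toℚᵘ-fromℚᵘ p)) (ℚᵘP.≃-sym (ℚP.toℚᵘ-fromℚᵘ q)))
               (ℚᵘP.≃-sym (ℚP.toℚᵘ-homo-+ (ℚ.fromℚᵘ p) (ℚ.fromℚᵘ q)))))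

recip-* : ∀ a b → recip (a ℕ.* b) ≡ recip a * recip b
recip-* zero    b    = sym (ℚP.*-zeroˡ (recip b))
recip-* (suc a) zero rewrite ℕP.*-zeroʳ a = sym (ℚP.*-zeroʳ (recip (suc a)))
recip-* (suc a) (suc b) = fromℚᵘ-homo-* (mkℚᵘ (ℤ.+ 1) a) (mkℚᵘ (ℤ.+ 1) b)

ι : ℕ → ℚ
ι n = ℚ.fromℚᵘ (mkℚᵘ (ℤ.+ n) 0)

ι-+ : ∀ a b → ι (a ℕ.+ b) ≡ ι a + ι b
ι-+ a b = trans (ℚP.fromℚᵘ-cong {mkℚᵘ (ℤ.+ (a ℕ.+ b)) 0} {mkℚᵘ (ℤ.+ a) 0 ℚᵘ.+ mkℚᵘ (ℤ.+ b) 0} (ℚᵘ.*≡* same-numerator)) (fromℚᵘ-homo-+ (mkℚᵘ (ℤ.+ a) 0) (mkℚᵘ (ℤ.+ b) 0))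
  where
  same-numerator : ℤ.+ (a ℕ.+ b) ℤ.* ℤ.+ 1 ≡ (ℤ.+ a ℤ.* ℤ.+ 1 ℤ.+ ℤ.+ b ℤ.* ℤ.+ 1) ℤ.* ℤ.+ 1
  same-numerator rewrite ℤP.*-identityʳ (ℤ.+ (a ℕ.+ b)) | ℤP.*-identityʳ (ℤ.+ a)
                       | ℤP.*-identityʳ (ℤ.+ b) | ℤP.*-identityʳ (ℤ.+ a ℤ.+ ℤ.+ b) = refl

ι-* : ∀ a b → ι (a ℕ.* b) ≡ ι a * ι b
ι-* a b = trans (ℚP.fromℚᵘ-cong {mkℚᵘ (ℤ.+ (a ℕ.* b)) 0} {mkℚᵘ (ℤ.+ a) 0 ℚᵘ.* mkℚᵘ (ℤ.+ b) 0} (ℚᵘ.*≡* (cong (ℤ._* ℤ.+ 1) (ℤP.pos-* a b))))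
                (fromℚᵘ-homo-* (mkℚᵘ (ℤ.+ a) 0) (mkℚᵘ (ℤ.+ b) 0))

ι-recip : ∀ n .{{_ : ℕ.NonZero n}} → ι n * recip n ≡ 1ℚ
ι-recip (suc k) = trans (sym (fromℚᵘ-homo-* (mkℚᵘ (ℤ.+ suc k) 0) (mkℚᵘ (ℤ.+ 1) k)))
                        (ℚP.fromℚᵘ-cong {mkℚᵘ (ℤ.+ suc k) 0 ℚᵘ.* mkℚᵘ (ℤ.+ 1) k} {mkℚᵘ (ℤ.+ 1) 0} (ℚᵘ.*≡* (cong (λ z → ℤ.+ suc z) k*1*1≡k+0+0)))
  where
  k*1*1≡k+0+0 : k ℕ.* 1 ℕ.* 1 ≡ k ℕ.+ 0 ℕ.+ 0
  k*1*1≡k+0+0 = trans (ℕP.*-identityʳ (k ℕ.* 1))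
                  (trans (ℕP.*-identityʳ k) (sym (trans (ℕP.+-identityʳ (k ℕ.+ 0)) (ℕP.+-identityʳ k))))

binomial-factorials : ∀ {n k} → k ℕ.≤ n → (n C k) ℕ.* (k ! ℕ.* (n ∸ k) !) ≡ n !
binomial-factorials {n} {k} k≤n =
  trans (cong (ℕ._* (k ! ℕ.* (n ∸ k) !)) (nCk≡n!/k![n-k]! k≤n)) (m/n*n≡m (k![n∸k]!∣n! k≤n))
  where instance _ = k ℕP.!* (n ∸ k) !≢0

binomial-recip : ∀ {n k} → k ℕ.≤ n → ι (n C k) * recip (n !) ≡ recip (k !) * recip ((n ∸ k) !)
binomial-recip {n} {k} k≤n = begin
  X * rN                      ≡⟨ solve 2 (λ x y → x :* y := (x :* y) :* (con 1ℚ :* con 1ℚ)) refl X rN ⟩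
  (X * rN) * (1ℚ * 1ℚ)        ≡⟨ cong₂ (λ u w → (X * rN) * (u * w)) (sym (ι-recip (k !))) (sym (ι-recip ((n ∸ k) !))) ⟩
  (X * rN) * ((A * ra) * (B * rb))
    ≡⟨ solve 6 (λ x y p q r s → (x :* y) :* ((p :* q) :* (r :* s)) := ((x :* (p :* r)) :* y) :* (q :* s))
             refl X rN A ra B rb ⟩
  ((X * (A * B)) * rN) * (ra * rb) ≡⟨ cong (λ z → (z * rN) * (ra * rb)) XAB≡n! ⟩
  (ι (n !) * rN) * (ra * rb)       ≡⟨ cong (_* (ra * rb)) (ι-recip (n !)) ⟩
  1ℚ * (ra * rb)                   ≡⟨ ℚP.*-identityˡ _ ⟩
  ra * rb                          ∎
  where
  instance _ = k ℕP.!≢0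
           _ = (n ∸ k) ℕP.!≢0
           _ = n ℕP.!≢0
  X = ι (n C k)
  rN = recip (n !)
  A = ι (k !)
  B = ι ((n ∸ k) !)
  ra = recip (k !)
  rb = recip ((n ∸ k) !)
  XAB≡n! : X * (A * B) ≡ ι (n !)
  XAB≡n! = trans (cong (X *_) (sym (ι-* (k !) ((n ∸ k) !))))
                 (trans (sym (ι-* (n C k) (k ! ℕ.* (n ∸ k) !))) (cong ι (binomial-factorials k≤n)))

pascal-sum : ∀ n (u : ℕ → ℚ) →
  sumBelow (suc n) (λ j → ι (n C j) * u j) + sumBelow (suc n) (λ j → ι (n C j) * u (suc j))
    ≡ sumBelow (suc (suc n)) (λ j → ι (suc n C j) * u j)
pascal-sum n u = begin
  sumBelow (suc n) (λ j → ι (n C j) * u j) + L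
    ≡⟨ cong (λ z → (ι 1 * u 0 + z) + L) (sym (sumBelow-extend n (suc n) R (ℕP.n≤1+n n) R-vanishes)) ⟩
  (ι 1 * u 0 + sumBelow (suc n) R) + L
    ≡⟨ solve 3 (λ x a b → (x :+ a) :+ b := x :+ (b :+ a)) refl (ι 1 * u 0) (sumBelow (suc n) R) L ⟩
  ι 1 * u 0 + (L + sumBelow (suc n) R)
    ≡⟨ cong (ι 1 * u 0 +_) (sym (sumBelow-+ (suc n) (λ j → ι (n C j) * u (suc j)) R)) ⟩
  ι 1 * u 0 + sumBelow (suc n) (λ j → ι (n C j) * u (suc j) + ι (n C suc j) * u (suc j))
    ≡⟨ cong (ι 1 * u 0 +_) (sumBelow-cong (suc n) (λ j _ → pascal j)) ⟩
  sumBelow (suc (suc n)) (λ j → ι (suc n C j) * u j) ∎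
  where
  -- L is the second summand; R is the first summand shifted by one index,
  -- whose extra term C(n,n+1) · u (n+1) vanishes
  L : ℚ
  L = sumBelow (suc n) (λ j → ι (n C j) * u (suc j))
  R : ℕ → ℚ
  R j = ι (n C suc j) * u (suc j)
  R-vanishes : ∀ k → n ℕ.≤ k → k ℕ.< suc n → R k ≡ 0ℚ
  R-vanishes k n≤k _ = trans (cong (λ z → ι z * u (suc k)) (k>n⇒nCk≡0 (s≤s n≤k))) (ℚP.*-zeroˡ (u (suc k)))
  pascal : ∀ j → ι (n C j) * u (suc j) + ι (n C suc j) * u (suc j) ≡ ι (suc n C suc j) * u (suc j)
  pascal j = trans (sym (ℚP.*-distribʳ-+ (u (suc j)) (ι (n C j)) (ι (n C suc j))))
                   (cong (_* u (suc j)) (trans (sym (ι-+ (n C j) (n C suc j))) (cong ι (nCk+nC[k+1]≡[n+1]C[k+1] n j))))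

objOf : (G : GradedFinGroupoid) → Fin (#Obj G) → Obj G
objOf G = Inverse.from (enumObj G)

earlierIso : (G : GradedFinGroupoid) → Fin (#Obj G) → Fin (#Obj G) → Bool
earlierIso G i j = (toℕ j <ᵇ toℕ i) ∧ not (#Hom G (objOf G j) (objOf G i) ≡ᵇ 0)

weight : (G : GradedFinGroupoid) → Obj G → ℚ
weight G o = signℚ (deg G o) * recip (#Hom G o o)

Linked : (G : GradedFinGroupoid) → Fin (#Obj G) → Fin (#Obj G) → Set
Linked G j i = NonZeroᵇ (#Hom G (objOf G j) (objOf G i))

earlierIso-intro : ∀ G i j → toℕ j ℕ.< toℕ i → Linked G j i → hasEarlierIso G i ≡ true
earlierIso-intro G i j j<i linked = any-intro (earlierIso G i) (∈-allFin j) (cong₂ _∧_ (<⇒<ᵇ j<i) linked)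

earlierIso-elim : ∀ G i → hasEarlierIso G i ≡ true →
                  Σ (Fin (#Obj G)) λ j → toℕ j ℕ.< toℕ i × Linked G j i
earlierIso-elim G i e with any-witness (earlierIso G i) (allFin (#Obj G)) e
... | j , ej with ∧-split {toℕ j <ᵇ toℕ i} ej
... | j<ᵇi , linked = j , <ᵇ⇒< _ _ j<ᵇi , linked

linked-refl : ∀ G i → Linked G i i
linked-refl G i = nonZeroᵇ-fin (Inverse.to (enumHom G (objOf G i) (objOf G i)) (idm G))

card-empty : ∀ G → (Obj G → ⊥) → card G ≡ 0ℚ
card-empty G noObj = go (#Obj G) (enumObj G) (classTerm G)
  where
  go : ∀ m → Obj G ↔ Fin m → (f : Fin m → ℚ) → sumℚ (map f (allFin m)) ≡ 0ℚ
  go zero    _ _ = refl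
  go (suc m) e _ = ⊥-elim (noObj (Inverse.from e Fin.zero))

card-shift : ∀ G → card (shift G) ≡ - card G
card-shift G = trans (sum-cong (allFin (#Obj G)) negated) (sum-map-neg (classTerm G) (allFin (#Obj G)))
  where
  negated-if : ∀ (h d : Bool) r → (if h then 0ℚ else signℚ (not d) * r) ≡ - (if h then 0ℚ else signℚ d * r)
  negated-if true  d     r = refl
  negated-if false false r = solve 1 (λ r → (:- con 1ℚ) :* r := :- (con 1ℚ :* r)) refl r
  negated-if false true  r = solve 1 (λ r → con 1ℚ :* r := :- ((:- con 1ℚ) :* r)) refl r
  negated : ∀ i → classTerm (shift G) i ≡ - classTerm G i
  negated i = negated-if (hasEarlierIso G i) (deg G (objOf G i)) (recip (#Hom G (objOf G i) (objOf G i)))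

card-shiftBy : ∀ k G → card (shiftBy k G) ≡ signed k (card G)
card-shiftBy zero    G = refl
card-shiftBy (suc k) G = trans (card-shift (shiftBy k G)) (cong -_ (card-shiftBy k G))

-- Disjoint union: objects of G are enumerated before those of H, and no
-- morphism connects the two summands, so class terms are unchanged.
module _ (G H : GradedFinGroupoid) where
  private
    m = #Obj G
    n = #Obj H

  objOf-⊔ˡ : ∀ (i : Fin m) → objOf (G ⊔ H) (i ↑ˡ n) ≡ inj₁ (objOf G i)
  objOf-⊔ˡ i rewrite splitAt-↑ˡ m i n = refl

  objOf-⊔ʳ : ∀ (i : Fin n) → objOf (G ⊔ H) (m ↑ʳ i) ≡ inj₂ (objOf H i)
  objOf-⊔ʳ i rewrite splitAt-↑ʳ m n i = refl

  hasEarlierIso-⊔ˡ : ∀ (i : Fin m) → hasEarlierIso (G ⊔ H) (i ↑ˡ n) ≡ hasEarlierIso G i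
  hasEarlierIso-⊔ˡ i =
    trans (any-allFin-+ m n (earlierIso (G ⊔ H) (i ↑ˡ n)))
          (trans (cong₂ _∨_ (any-cong (allFin m) fromG) (any-false (allFin n) fromH))
                 (BoolP.∨-identityʳ _))
    where
    fromG : ∀ j → earlierIso (G ⊔ H) (i ↑ˡ n) (j ↑ˡ n) ≡ earlierIso G i j
    fromG j = cong₂ _∧_ (cong₂ _<ᵇ_ (toℕ-↑ˡ j n) (toℕ-↑ˡ i n))
                        (cong₂ (λ a b → not (#Hom (G ⊔ H) a b ≡ᵇ 0)) (objOf-⊔ˡ j) (objOf-⊔ˡ i))
    -- objects of H come later in the enumeration
    fromH : ∀ j → earlierIso (G ⊔ H) (i ↑ˡ n) (m ↑ʳ j) ≡ false
    fromH j = cong (_∧ not (#Hom (G ⊔ H) (objOf (G ⊔ H) (m ↑ʳ j)) (objOf (G ⊔ H) (i ↑ˡ n)) ≡ᵇ 0))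
      (≤⇒≮ᵇ (toℕ (m ↑ʳ j)) (toℕ (i ↑ˡ n))
        (subst₂ ℕ._≤_ (sym (toℕ-↑ˡ i n)) (sym (toℕ-↑ʳ m j))
          (ℕP.≤-trans (ℕP.<⇒≤ (toℕ<n i)) (ℕP.m≤m+n m (toℕ j)))))

  hasEarlierIso-⊔ʳ : ∀ (i : Fin n) → hasEarlierIso (G ⊔ H) (m ↑ʳ i) ≡ hasEarlierIso H i
  hasEarlierIso-⊔ʳ i =
    trans (any-allFin-+ m n (earlierIso (G ⊔ H) (m ↑ʳ i)))
          (cong₂ _∨_ (any-false (allFin m) fromG) (any-cong (allFin n) fromH))
    where
    -- there are no morphisms from G to H
    fromG : ∀ j → earlierIso (G ⊔ H) (m ↑ʳ i) (j ↑ˡ n) ≡ false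
    fromG j = trans (cong ((toℕ (j ↑ˡ n) <ᵇ toℕ (m ↑ʳ i)) ∧_)
                          (cong₂ (λ a b → not (#Hom (G ⊔ H) a b ≡ᵇ 0)) (objOf-⊔ˡ j) (objOf-⊔ʳ i)))
                    (BoolP.∧-zeroʳ _)
    fromH : ∀ j → earlierIso (G ⊔ H) (m ↑ʳ i) (m ↑ʳ j) ≡ earlierIso H i j
    fromH j = cong₂ _∧_ (trans (cong₂ _<ᵇ_ (toℕ-↑ʳ m j) (toℕ-↑ʳ m i)) (+-cancel-<ᵇ m (toℕ j) (toℕ i)))
                        (cong₂ (λ a b → not (#Hom (G ⊔ H) a b ≡ᵇ 0)) (objOf-⊔ʳ j) (objOf-⊔ʳ i))

  card-⊔ : card (G ⊔ H) ≡ card G + card H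
  card-⊔ = begin
    sumℚ (map (classTerm (G ⊔ H)) (allFin (m ℕ.+ n)))
      ≡⟨ cong (λ l → sumℚ (map (classTerm (G ⊔ H)) l)) (allFin-+ m n) ⟩
    sumℚ (map (classTerm (G ⊔ H)) (map (_↑ˡ n) (allFin m) ++ map (m ↑ʳ_) (allFin n)))
      ≡⟨ cong sumℚ (LP.map-++ (classTerm (G ⊔ H)) (map (_↑ˡ n) (allFin m)) _) ⟩
    sumℚ (map (classTerm (G ⊔ H)) (map (_↑ˡ n) (allFin m)) ++ map (classTerm (G ⊔ H)) (map (m ↑ʳ_) (allFin n)))
      ≡⟨ sum-++ (map (classTerm (G ⊔ H)) (map (_↑ˡ n) (allFin m))) _ ⟩
    sumℚ (map (classTerm (G ⊔ H)) (map (_↑ˡ n) (allFin m))) + sumℚ (map (classTerm (G ⊔ H)) (map (m ↑ʳ_) (allFin n)))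
      ≡⟨ cong₂ _+_ (trans (cong sumℚ (sym (LP.map-∘ (allFin m)))) (sum-cong (allFin m) classTerm-⊔ˡ))
                   (trans (cong sumℚ (sym (LP.map-∘ (allFin n)))) (sum-cong (allFin n) classTerm-⊔ʳ)) ⟩
    card G + card H ∎
    where
    classTerm-⊔ˡ : ∀ i → classTerm (G ⊔ H) (i ↑ˡ n) ≡ classTerm G i
    classTerm-⊔ˡ i = cong₂ (λ b o → if b then 0ℚ else weight (G ⊔ H) o) (hasEarlierIso-⊔ˡ i) (objOf-⊔ˡ i)
    classTerm-⊔ʳ : ∀ i → classTerm (G ⊔ H) (m ↑ʳ i) ≡ classTerm H i
    classTerm-⊔ʳ i = cong₂ (λ b o → if b then 0ℚ else weight (G ⊔ H) o) (hasEarlierIso-⊔ʳ i) (objOf-⊔ʳ i)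

-- Lexicographic order on pairs, as realised by the index n·a + b of combine.
lex-< : ∀ n {a a' b b'} → a' ℕ.< a → b' ℕ.< n → n ℕ.* a' ℕ.+ b' ℕ.< n ℕ.* a ℕ.+ b
lex-< n {a} {a'} {b} {b'} a'<a b'<n =
  ℕP.<-≤-trans (ℕP.+-monoʳ-< (n ℕ.* a') b'<n)
    (ℕP.≤-trans (ℕP.≤-reflexive (trans (ℕP.+-comm (n ℕ.* a') n) (sym (ℕP.*-suc n a'))))
      (ℕP.≤-trans (ℕP.*-monoʳ-≤ n a'<a) (ℕP.m≤m+n (n ℕ.* a) b)))

lex-<-inv : ∀ n {a a' b b'} → b ℕ.< n → b' ℕ.< n → n ℕ.* a' ℕ.+ b' ℕ.< n ℕ.* a ℕ.+ b →
            a' ℕ.< a ⊎ (a' ≡ a × b' ℕ.< b)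
lex-<-inv n {a} {a'} {b} {b'} b<n b'<n lt with ℕP.<-cmp a' a
... | tri< a'<a _ _ = inj₁ a'<a
... | tri≈ _ refl _ = inj₂ (refl , ℕP.+-cancelˡ-< (n ℕ.* a) b' b lt)
... | tri> _ _ a<a' = ⊥-elim (ℕP.<-asym lt (lex-< n a<a' b<n))

-- Product: objects are enumerated lexicographically, and (a,b) has an earlier
-- isomorphic object iff a or b does; weights multiply.
module _ (G H : GradedFinGroupoid) where
  private
    m = #Obj G
    n = #Obj H

  objOf-⊗ : ∀ (a : Fin m) (b : Fin n) → objOf (G ⊗ H) (combine a b) ≡ (objOf G a , objOf H b)
  objOf-⊗ a b = cong (λ p → (objOf G (proj₁ p) , objOf H (proj₂ p))) (remQuot-combine {m} {n} a b)

  linked-⊗⁻ : ∀ {a a' b b'} → Linked (G ⊗ H) (combine a' b') (combine a b) → Linked G a' a × Linked H b' b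
  linked-⊗⁻ {a} {a'} {b} {b'} linked = nonZeroᵇ-*ˡ homsG homsH linked' , nonZeroᵇ-*ʳ homsG homsH linked'
    where
    homsG = #Hom G (objOf G a') (objOf G a)
    homsH = #Hom H (objOf H b') (objOf H b)
    linked' : NonZeroᵇ (homsG ℕ.* homsH)
    linked' = subst₂ (λ o o' → NonZeroᵇ (#Hom (G ⊗ H) o o')) (objOf-⊗ a' b') (objOf-⊗ a b) linked

  linked-⊗ : ∀ {a a' b b'} → Linked G a' a → Linked H b' b → Linked (G ⊗ H) (combine a' b') (combine a b)
  linked-⊗ {a} {a'} {b} {b'} linkedG linkedH =
    subst₂ (λ o o' → NonZeroᵇ (#Hom (G ⊗ H) o o')) (sym (objOf-⊗ a' b')) (sym (objOf-⊗ a b))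
      (nonZeroᵇ-* (#Hom G (objOf G a') (objOf G a)) (#Hom H (objOf H b') (objOf H b)) linkedG linkedH)

  hasEarlierIso-⊗ : ∀ a b → hasEarlierIso (G ⊗ H) (combine a b) ≡ hasEarlierIso G a ∨ hasEarlierIso H b
  hasEarlierIso-⊗ a b = bool-ext to from
    where
    -- an earlier linked pair (a',b') has a' earlier than a, or a' = a and b' earlier than b
    earlierPair : ∀ a' b' → toℕ (combine a' b') ℕ.< toℕ (combine a b) →
                  Linked (G ⊗ H) (combine a' b') (combine a b) → hasEarlierIso G a ∨ hasEarlierIso H b ≡ true
    earlierPair a' b' lt linked
      with linked-⊗⁻ linked
         | lex-<-inv n (toℕ<n b) (toℕ<n b') (subst₂ ℕ._<_ (toℕ-combine a' b') (toℕ-combine a b) lt)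
    ... | linkedG , _ | inj₁ a'<a rewrite earlierIso-intro G a a' a'<a linkedG = refl
    ... | _ , linkedH | inj₂ (_ , b'<b) rewrite earlierIso-intro H b b' b'<b linkedH = BoolP.∨-zeroʳ _
    to : hasEarlierIso (G ⊗ H) (combine a b) ≡ true → hasEarlierIso G a ∨ hasEarlierIso H b ≡ true
    to e with earlierIso-elim (G ⊗ H) (combine a b) e
    ... | j , j<ab , linked =
      earlierPair (proj₁ (remQuot {m} n j)) (proj₂ (remQuot {m} n j))
        (subst (λ k → toℕ k ℕ.< toℕ (combine a b)) j≡ j<ab)
        (subst (λ k → Linked (G ⊗ H) k (combine a b)) j≡ linked)
      where j≡ = sym (combine-remQuot {m} n j)
    from : hasEarlierIso G a ∨ hasEarlierIso H b ≡ true → hasEarlierIso (G ⊗ H) (combine a b) ≡ true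
    from e with ∨-split {hasEarlierIso G a} e
    ... | inj₁ eG with earlierIso-elim G a eG
    ...   | a' , a'<a , linkedG = earlierIso-intro (G ⊗ H) (combine a b) (combine a' b)
            (subst₂ ℕ._<_ (sym (toℕ-combine a' b)) (sym (toℕ-combine a b)) (lex-< n a'<a (toℕ<n b)))
            (linked-⊗ linkedG (linked-refl H b))
    from e | inj₂ eH with earlierIso-elim H b eH
    ...   | b' , b'<b , linkedH = earlierIso-intro (G ⊗ H) (combine a b) (combine a b')
            (subst₂ ℕ._<_ (sym (toℕ-combine a b')) (sym (toℕ-combine a b)) (ℕP.+-monoʳ-< (n ℕ.* toℕ a) b'<b))
            (linked-⊗ (linked-refl G a) linkedH)

  classTerm-⊗ : ∀ a b → classTerm (G ⊗ H) (combine a b) ≡ classTerm G a * classTerm H b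
  classTerm-⊗ a b =
    trans (cong₂ (λ e o → if e then 0ℚ else weight (G ⊗ H) o) (hasEarlierIso-⊗ a b) (objOf-⊗ a b))
          (split (hasEarlierIso G a) (hasEarlierIso H b) (deg G (objOf G a)) (deg H (objOf H b))
                 (#Hom G (objOf G a) (objOf G a)) (#Hom H (objOf H b) (objOf H b)))
    where
    signℚ-xor : ∀ x y → signℚ (x xor y) ≡ signℚ x * signℚ y
    signℚ-xor false false = refl
    signℚ-xor false true  = refl
    signℚ-xor true  false = refl
    signℚ-xor true  true  = refl
    split : ∀ eG eH dG dH rG rH →
      (if eG ∨ eH then 0ℚ else signℚ (dG xor dH) * recip (rG ℕ.* rH)) ≡
      (if eG then 0ℚ else signℚ dG * recip rG) * (if eH then 0ℚ else signℚ dH * recip rH)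
    split true  eH    dG dH rG rH = sym (ℚP.*-zeroˡ (if eH then 0ℚ else signℚ dH * recip rH))
    split false true  dG dH rG rH = sym (ℚP.*-zeroʳ (signℚ dG * recip rG))
    split false false dG dH rG rH = trans (cong₂ _*_ (signℚ-xor dG dH) (recip-* rG rH))
      (solve 4 (λ a b c d → (a :* b) :* (c :* d) := (a :* c) :* (b :* d)) refl
         (signℚ dG) (signℚ dH) (recip rG) (recip rH))

  card-⊗ : card (G ⊗ H) ≡ card G * card H
  card-⊗ = begin
    sumℚ (map (classTerm (G ⊗ H)) (allFin (m ℕ.* n)))
      ≡⟨ cong (λ l → sumℚ (map (classTerm (G ⊗ H)) l)) (allFin-* m n) ⟩
    sumℚ (map (classTerm (G ⊗ H)) (concatMap (λ a → map (combine a) (allFin n)) (allFin m)))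
      ≡⟨ sum-concatMap (classTerm (G ⊗ H)) (λ a → map (combine a) (allFin n)) (allFin m) ⟩
    sumℚ (map (λ a → sumℚ (map (classTerm (G ⊗ H)) (map (combine a) (allFin n)))) (allFin m))
      ≡⟨ sum-cong (allFin m) row ⟩
    sumℚ (map (λ a → classTerm G a * card H) (allFin m))
      ≡⟨ sum-map-*ʳ (card H) (classTerm G) (allFin m) ⟩
    card G * card H ∎
    where
    row : ∀ a → sumℚ (map (classTerm (G ⊗ H)) (map (combine a) (allFin n))) ≡ classTerm G a * card H
    row a = trans (cong sumℚ (sym (LP.map-∘ (allFin n))))
              (trans (sum-cong (allFin n) (classTerm-⊗ a))
                     (sum-map-*ˡ (classTerm G a) (classTerm H) (allFin n)))

card-⨆ : ∀ L → card (⨆ L) ≡ sumℚ (map card L)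
card-⨆ []      = refl
card-⨆ (G ∷ L) = trans (card-⊔ G (⨆ L)) (cong (card G +_) (card-⨆ L))

card-∏ : ∀ L → card (∏ L) ≡ prodℚ (map card L)
card-∏ []      = refl
card-∏ (G ∷ L) = trans (card-⊗ G (∏ L)) (cong (card G *_) (card-∏ L))

-- Words.  A word v ∈ [k+1]ⁿ is determined by the positions of its letter 0
-- and by the word over [k] formed by its other letters, decremented.

zeros : ∀ {k n} → Vec (Fin (suc k)) n → ℕ
zeros v = blockSize v Fin.zero

strip : ∀ {k n} → Vec (Fin (suc k)) n → Σ ℕ (Vec (Fin k))
strip Vec.[]                = 0 , Vec.[]
strip (Fin.zero  Vec.∷ v)   = strip v
strip (Fin.suc b Vec.∷ v)   = suc (proj₁ (strip v)) , b Vec.∷ proj₂ (strip v)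

blockSize-strip : ∀ {k n} (v : Vec (Fin (suc k)) n) i → blockSize v (Fin.suc i) ≡ blockSize (proj₂ (strip v)) i
blockSize-strip Vec.[]              i = refl
blockSize-strip (Fin.zero  Vec.∷ v) i = blockSize-strip v i
blockSize-strip (Fin.suc b Vec.∷ v) i with b Fin.≟ i
... | yes _ = cong suc (blockSize-strip v i)
... | no  _ = blockSize-strip v i

blockSize-∉ : ∀ {k n} (i : Fin k) (v : Vec (Fin k) n) → ¬ (i VecMem.∈ v) → blockSize v i ≡ 0
blockSize-∉ i Vec.[]         _ = refl
blockSize-∉ i (x Vec.∷ v) i∉v with x Fin.≟ i
... | yes x≡i = ⊥-elim (i∉v (vhere (sym x≡i)))
... | no  _   = blockSize-∉ i v (λ i∈v → i∉v (vthere i∈v))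

sumWords : ∀ {k} → (Σ ℕ (Vec (Fin k)) → ℚ) → ℕ → ℚ
sumWords {k} Q j = sumℚ (map (λ u → Q (j , u)) (allVecs k j))

sumWords-suc : ∀ {k} (Q : Σ ℕ (Vec (Fin k)) → ℚ) j →
  sumℚ (map (λ b → sumWords (λ p → Q (suc (proj₁ p) , b Vec.∷ proj₂ p)) j) (allFin k)) ≡ sumWords Q (suc j)
sumWords-suc {k} Q j = sym (trans
  (sum-concatMap (λ u → Q (suc j , u)) (λ b → map (b Vec.∷_) (allVecs k j)) (allFin k))
  (sum-cong (allFin k) (λ b → cong sumℚ (sym (LP.map-∘ (allVecs k j))))))

split-words : ∀ {k} n (h : ℕ → ℚ) (Q : Σ ℕ (Vec (Fin k)) → ℚ) →
  sumℚ (map (λ v → h (zeros v) * Q (strip v)) (allVecs (suc k) n))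
    ≡ sumBelow (suc n) (λ j → ι (n C j) * (h (n ∸ j) * sumWords Q j))
split-words zero h Q =
  solve 2 (λ x y → x :* y :+ con 0ℚ := (con 1ℚ :* (x :* (y :+ con 0ℚ))) :+ con 0ℚ) refl (h 0) (Q (0 , Vec.[]))
split-words {k} (suc n) h Q = begin
  sumℚ (map φ (concatMap (λ a → map (a Vec.∷_) V) (allFin (suc k))))
    ≡⟨ sum-concatMap φ (λ a → map (a Vec.∷_) V) (allFin (suc k)) ⟩
  sumℚ (map (λ a → sumℚ (map φ (map (a Vec.∷_) V))) (allFin (suc k)))
    ≡⟨ cong (λ l → sumℚ (map (λ a → sumℚ (map φ (map (a Vec.∷_) V))) l)) (allFin-suc k) ⟩
  sumℚ (map φ (map (Fin.zero Vec.∷_) V)) + sumℚ (map (λ a → sumℚ (map φ (map (a Vec.∷_) V))) (map Fin.suc (allFin k)))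
    ≡⟨ cong₂ _+_ leading-zero leading-nonzero ⟩
  sumBelow (suc n) (λ j → ι (n C j) * u j) + sumBelow (suc n) (λ j → ι (n C j) * u (suc j))
    ≡⟨ pascal-sum n u ⟩
  sumBelow (suc (suc n)) (λ j → ι (suc n C j) * u j) ∎
  where
  V = allVecs (suc k) n
  φ : Vec (Fin (suc k)) (suc n) → ℚ
  φ v = h (zeros v) * Q (strip v)
  u : ℕ → ℚ
  u j = h (suc n ∸ j) * sumWords Q j
  -- words starting with 0: one more zero, same stripped word
  leading-zero : sumℚ (map φ (map (Fin.zero Vec.∷_) V)) ≡ sumBelow (suc n) (λ j → ι (n C j) * u j)
  leading-zero = trans (cong sumℚ (sym (LP.map-∘ V)))
    (trans (split-words n (λ z → h (suc z)) Q)
           (sumBelow-cong (suc n) (λ j j≤n → cong (λ z → ι (n C j) * (h z * sumWords Q j))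
                                                   (sym (ℕP.+-∸-assoc 1 (ℕP.≤-pred j≤n))))))
  -- words starting with b+1: the stripped word starts with b
  Qb : Fin k → Σ ℕ (Vec (Fin k)) → ℚ
  Qb b p = Q (suc (proj₁ p) , b Vec.∷ proj₂ p)
  leading-nonzero : sumℚ (map (λ a → sumℚ (map φ (map (a Vec.∷_) V))) (map Fin.suc (allFin k)))
                  ≡ sumBelow (suc n) (λ j → ι (n C j) * u (suc j))
  leading-nonzero = begin
    sumℚ (map (λ a → sumℚ (map φ (map (a Vec.∷_) V))) (map Fin.suc (allFin k)))
      ≡⟨ cong sumℚ (sym (LP.map-∘ (allFin k))) ⟩
    sumℚ (map (λ b → sumℚ (map φ (map (Fin.suc b Vec.∷_) V))) (allFin k))
      ≡⟨ sum-cong (allFin k) (λ b → trans (cong sumℚ (sym (LP.map-∘ V))) (split-words n h (Qb b))) ⟩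
    sumℚ (map (λ b → sumBelow (suc n) (λ j → ι (n C j) * (h (n ∸ j) * sumWords (Qb b) j))) (allFin k))
      ≡⟨ sum-sumBelow-swap (suc n) (λ b j → ι (n C j) * (h (n ∸ j) * sumWords (Qb b) j)) (allFin k) ⟩
    sumBelow (suc n) (λ j → sumℚ (map (λ b → ι (n C j) * (h (n ∸ j) * sumWords (Qb b) j)) (allFin k)))
      ≡⟨ sumBelow-cong (suc n) (λ j _ → trans (sum-map-*ˡ (ι (n C j)) _ (allFin k))
           (cong (ι (n C j) *_) (trans (sum-map-*ˡ (h (n ∸ j)) _ (allFin k)) (cong (h (n ∸ j) *_) (sumWords-suc Q j))))) ⟩
    sumBelow (suc n) (λ j → ι (n C j) * u (suc j)) ∎

module Coefficients (F : Species) (F∅-empty : Obj (grp F 0) → ⊥) where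

  c : ℕ → ℚ
  c m = card (grp F m)

  c-0 : c 0 ≡ 0ℚ
  c-0 = card-empty (grp F 0) F∅-empty

  f : ℕ → ℚ
  f = ∣ F ∣ₛ

  wordWeight : ∀ k {n} → Vec (Fin k) n → ℚ
  wordWeight k v = prodℚ (map (λ i → c (blockSize v i)) (allFin k))

  T : ℕ → ℕ → ℚ
  T k n = sumℚ (map (wordWeight k) (allVecs k n))

  t : ℕ → ℕ → ℚ
  t k n = T k n * recip (n !)

  wordWeight-split : ∀ {k n} (v : Vec (Fin (suc k)) n) →
                     wordWeight (suc k) v ≡ c (zeros v) * wordWeight k (proj₂ (strip v))
  wordWeight-split {k} v = begin
    prodℚ (map (λ i → c (blockSize v i)) (allFin (suc k)))
      ≡⟨ cong (λ l → prodℚ (map (λ i → c (blockSize v i)) l)) (allFin-suc k) ⟩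
    c (zeros v) * prodℚ (map (λ i → c (blockSize v i)) (map Fin.suc (allFin k)))
      ≡⟨ cong (λ l → c (zeros v) * prodℚ l)
              (trans (sym (LP.map-∘ (allFin k))) (LP.map-cong (λ i → cong c (blockSize-strip v i)) (allFin k))) ⟩
    c (zeros v) * wordWeight k (proj₂ (strip v)) ∎

  -- t (k+1) = t k · f as power series: t k are the coefficients of fᵏ
  t-suc : ∀ k n → t (suc k) n ≡ sumBelow (suc n) (λ j → t k j * f (n ∸ j))
  t-suc k n = begin
    T (suc k) n * recip (n !)
      ≡⟨ cong (_* recip (n !)) (trans (sum-cong (allVecs (suc k) n) wordWeight-split)
                                      (split-words n c (λ p → wordWeight k (proj₂ p)))) ⟩
    sumBelow (suc n) (λ j → ι (n C j) * (c (n ∸ j) * T k j)) * recip (n !)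
      ≡⟨ sym (sumBelow-*ʳ (suc n) (recip (n !)) (λ j → ι (n C j) * (c (n ∸ j) * T k j))) ⟩
    sumBelow (suc n) (λ j → ι (n C j) * (c (n ∸ j) * T k j) * recip (n !))
      ≡⟨ sumBelow-cong (suc n) (λ j j<1+n → term j (ℕP.≤-pred j<1+n)) ⟩
    sumBelow (suc n) (λ j → t k j * f (n ∸ j)) ∎
    where
    term : ∀ j → j ℕ.≤ n → ι (n C j) * (c (n ∸ j) * T k j) * recip (n !) ≡ t k j * f (n ∸ j)
    term j j≤n = begin
      ι (n C j) * (c (n ∸ j) * T k j) * recip (n !)
        ≡⟨ solve 4 (λ a b d e → a :* (b :* d) :* e := (a :* e) :* (b :* d)) refl
                 (ι (n C j)) (c (n ∸ j)) (T k j) (recip (n !)) ⟩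
      (ι (n C j) * recip (n !)) * (c (n ∸ j) * T k j)
        ≡⟨ cong (_* (c (n ∸ j) * T k j)) (binomial-recip j≤n) ⟩
      (recip (j !) * recip ((n ∸ j) !)) * (c (n ∸ j) * T k j)
        ≡⟨ solve 4 (λ a b d e → (a :* b) :* (d :* e) := (e :* a) :* (d :* b)) refl
                 (recip (j !)) (recip ((n ∸ j) !)) (c (n ∸ j)) (T k j) ⟩
      t k j * f (n ∸ j) ∎

  t-zero : ∀ n → t 0 n ≡ 1ₛ n
  t-zero zero    = refl
  t-zero (suc n) = ℚP.*-zeroˡ (recip (suc n !))

  -- fᵏ has no terms below xᵏ, since f has no constant term
  t-vanishes : ∀ k n → n ℕ.< k → t k n ≡ 0ℚ
  t-vanishes (suc k) n n<1+k = trans (t-suc k n) (sumBelow-zero (suc n) term-vanishes)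
    where
    term-vanishes : ∀ j → j ℕ.< suc n → t k j * f (n ∸ j) ≡ 0ℚ
    term-vanishes j j<1+n with ℕP.m≤n⇒m<n∨m≡n (ℕP.≤-pred j<1+n)
    ... | inj₁ j<n  = trans (cong (_* f (n ∸ j)) (t-vanishes k j (ℕP.<-≤-trans j<n (ℕP.≤-pred n<1+k))))
                            (ℚP.*-zeroˡ (f (n ∸ j)))
    ... | inj₂ refl = trans (cong (λ m → t k j * f m) (ℕP.n∸n≡0 j))
                            (trans (cong (λ z → t k j * (z * recip 1)) c-0) (ℚP.*-zeroʳ (t k j)))

  -- Summing over surjective words only is the same as summing over all words,
  -- since a missing letter gives an empty block, of weight c 0 = 0.
  sum-orderedPartitions : ∀ k n → sumℚ (map (wordWeight k) (orderedPartitions k n)) ≡ T k n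
  sum-orderedPartitions k n = sum-filter surjective? (wordWeight k) (allVecs k n) non-surjective
    where
    non-surjective : ∀ v → ¬ Surjective v → wordWeight k v ≡ 0ℚ
    non-surjective v ¬surj with ¬∀⟶∃¬ k (λ i → i VecMem.∈ v) (λ i → VecDec._∈?_ Fin._≟_ i v) ¬surj
    ... | i , i∉v = prod-zero (λ i → c (blockSize v i)) (∈-allFin i) (trans (cong c (blockSize-∉ i v i∉v)) c-0)

  card-inverse : ∀ n → card (invSpeciesAt F n) ≡ sumBelow (suc n) (λ k → signed k (T k n))
  card-inverse n = begin
    card (invSpeciesAt F n)
      ≡⟨ card-⨆ (concatMap summands (upTo (suc n))) ⟩
    sumℚ (map card (concatMap summands (upTo (suc n))))
      ≡⟨ sum-concatMap card summands (upTo (suc n)) ⟩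
    sumℚ (map (λ k → sumℚ (map card (summands k))) (upTo (suc n)))
      ≡⟨ sum-cong (upTo (suc n)) card-summands ⟩
    sumℚ (map (λ k → signed k (T k n)) (upTo (suc n)))
      ≡⟨ upTo-sumBelow (suc n) (λ k → signed k (T k n)) ⟩
    sumBelow (suc n) (λ k → signed k (T k n)) ∎
    where
    blocks : ∀ k → Vec (Fin k) n → GradedFinGroupoid
    blocks k v = ∏ (map (λ i → grp F (blockSize v i)) (allFin k))
    summands : ℕ → List GradedFinGroupoid
    summands k = map (λ v → shiftBy k (blocks k v)) (orderedPartitions k n)
    card-blocks : ∀ k v → card (shiftBy k (blocks k v)) ≡ signed k (wordWeight k v)
    card-blocks k v = trans (card-shiftBy k (blocks k v))
      (cong (signed k) (trans (card-∏ (map (λ i → grp F (blockSize v i)) (allFin k)))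
                              (cong prodℚ (sym (LP.map-∘ (allFin k))))))
    card-summands : ∀ k → sumℚ (map card (summands k)) ≡ signed k (T k n)
    card-summands k = begin
      sumℚ (map card (summands k))
        ≡⟨ trans (cong sumℚ (sym (LP.map-∘ (orderedPartitions k n)))) (sum-cong (orderedPartitions k n) (card-blocks k)) ⟩
      sumℚ (map (λ v → signed k (wordWeight k v)) (orderedPartitions k n))
        ≡⟨ sum-signed k (wordWeight k) (orderedPartitions k n) ⟩
      signed k (sumℚ (map (wordWeight k) (orderedPartitions k n)))
        ≡⟨ cong (signed k) (sum-orderedPartitions k n) ⟩
      signed k (T k n) ∎

  g : ℕ → ℚ
  g = genSeriesOf (invSpeciesAt F)

  g-coefficient : ∀ n → g n ≡ sumBelow (suc n) (λ k → signed k (t k n))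
  g-coefficient n = trans (cong (_* recip (n !)) (card-inverse n))
    (trans (sym (sumBelow-*ʳ (suc n) (recip (n !)) (λ k → signed k (T k n))))
           (sumBelow-cong (suc n) (λ k _ → signed-*ʳ k (T k n) (recip (n !)))))

  g-*-one : ∀ n → sumBelow (suc n) (λ j → g j * 1ₛ (n ∸ j)) ≡ sumBelow (suc n) (λ k → signed k (t k n))
  g-*-one n = begin
    sumBelow (suc n) (λ j → g j * 1ₛ (n ∸ j))
      ≡⟨ sumBelow-last n _ ⟩
    sumBelow n (λ j → g j * 1ₛ (n ∸ j)) + g n * 1ₛ (n ∸ n)
      ≡⟨ cong₂ _+_ (sumBelow-zero n (λ j j<n → trans (cong (g j *_) (one-vanishes (ℕP.m<n⇒0<n∸m j<n))) (ℚP.*-zeroʳ (g j))))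
                   (trans (cong (λ m → g n * 1ₛ m) (ℕP.n∸n≡0 n)) (ℚP.*-identityʳ (g n))) ⟩
    0ℚ + g n
      ≡⟨ ℚP.+-identityˡ (g n) ⟩
    g n
      ≡⟨ g-coefficient n ⟩
    sumBelow (suc n) (λ k → signed k (t k n)) ∎
    where
    one-vanishes : ∀ {m} → 0 ℕ.< m → 1ₛ m ≡ 0ℚ
    one-vanishes {suc m} _ = refl

  g-*-f : ∀ n → sumBelow (suc n) (λ j → g j * f (n ∸ j)) ≡ sumBelow (suc n) (λ k → signed k (t (suc k) n))
  g-*-f n = begin
    sumBelow (suc n) (λ j → g j * f (n ∸ j))
      ≡⟨ sumBelow-cong (suc n) (λ j j<1+n → trans (cong (_* f (n ∸ j)) (g-full-range j j<1+n))
                                                 (sym (sumBelow-*ʳ (suc n) (f (n ∸ j)) (λ k → signed k (t k j))))) ⟩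
    sumBelow (suc n) (λ j → sumBelow (suc n) (λ k → signed k (t k j) * f (n ∸ j)))
      ≡⟨ sumBelow-swap (suc n) (suc n) (λ j k → signed k (t k j) * f (n ∸ j)) ⟩
    sumBelow (suc n) (λ k → sumBelow (suc n) (λ j → signed k (t k j) * f (n ∸ j)))
      ≡⟨ sumBelow-cong (suc n) (λ k _ → trans (sumBelow-cong (suc n) (λ j _ → signed-*ʳ k (t k j) (f (n ∸ j))))
           (trans (sumBelow-signed k (suc n) (λ j → t k j * f (n ∸ j))) (cong (signed k) (sym (t-suc k n))))) ⟩
    sumBelow (suc n) (λ k → signed k (t (suc k) n)) ∎
    where
    -- for j ≤ n the sum for g j may run over k ≤ n, as t k j = 0 for j < k
    g-full-range : ∀ j → j ℕ.< suc n → g j ≡ sumBelow (suc n) (λ k → signed k (t k j))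
    g-full-range j j<1+n = trans (g-coefficient j)
      (sym (sumBelow-extend (suc j) (suc n) (λ k → signed k (t k j)) j<1+n
             (λ k j<k _ → trans (cong (signed k) (t-vanishes k j j<k)) (signed-0 k))))

-- Main theorem: |(1+F)⁻¹| · (1 + |F|) = 1.  Coefficientwise,
--   g · (1 + f) = Σ_k (-1)ᵏ fᵏ + Σ_k (-1)ᵏ fᵏ⁺¹,
-- which telescopes to f⁰ = 1 up to the term (-1)ⁿ t (n+1) n = 0.
mainTheorem2 : (F : Species) → (Obj (grp F 0) → ⊥) →
               (genSeriesOf (invSpeciesAt F) *ₛ (1ₛ +ₛ ∣ F ∣ₛ)) ≈ₛ 1ₛ
mainTheorem2 F F∅-empty n = begin
  (g *ₛ (1ₛ +ₛ f)) n
    ≡⟨ upTo-sumBelow (suc n) (λ j → g j * (1ₛ (n ∸ j) + f (n ∸ j))) ⟩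
  sumBelow (suc n) (λ j → g j * (1ₛ (n ∸ j) + f (n ∸ j)))
    ≡⟨ trans (sumBelow-cong (suc n) (λ j _ → ℚP.*-distribˡ-+ (g j) (1ₛ (n ∸ j)) (f (n ∸ j))))
             (sumBelow-+ (suc n) (λ j → g j * 1ₛ (n ∸ j)) (λ j → g j * f (n ∸ j))) ⟩
  sumBelow (suc n) (λ j → g j * 1ₛ (n ∸ j)) + sumBelow (suc n) (λ j → g j * f (n ∸ j))
    ≡⟨ cong₂ _+_ (g-*-one n) (g-*-f n) ⟩
  sumBelow (suc n) (λ k → signed k (t k n)) + sumBelow (suc n) (λ k → signed k (t (suc k) n))
    ≡⟨ telescope n (λ k → t k n) ⟩
  t 0 n + signed n (t (suc n) n)
    ≡⟨ cong₂ _+_ (t-zero n) (trans (cong (signed n) (t-vanishes (suc n) n ℕP.≤-refl)) (signed-0 n)) ⟩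
  1ₛ n + 0ℚ
    ≡⟨ ℚP.+-identityʳ _ ⟩
  1ₛ n ∎
  where open Coefficients F F∅-empty
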